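{- Let $\mathcal{A}$ be a computable injection structure with an infinite orbit, let $C$ be a cohesive set, and let $\mathcal{B}=\prod_C\mathcal{A}$. Then $\mathcal{B}$ has infinitely many $Z$-orbits. Consequently, if $\mathcal{A}$ has an infinite orbit but at most finitely many $Z$-orbits, then $\mathcal{A}\not\cong\prod_C\mathcal{A}$.
   Context: An injection structure $(A,f)$ is a nonempty set $A$ with a one-to-one total function $f:A\to A$; it is computable if $A\subseteq\omega$ and $f$ are computable. The orbit of $a$ is $\mathcal{O}_f(a)=\{b\in A:\exists n\in\omega\,[f^n(a)=b\vee f^n(b)=a]\}$. An infinite orbit all of whose elements lie in the range of $f$ is a $Z$-orbit. A set $C\subseteq\omega$ is cohesive if it is infinite and for every c.e. set $W$, one of $W\cap C$, $\overline{W}\cap C$ is finite; $X\subseteq^*Y$ means $X\setminus Y$ is finite. The cohesive power $\prod_C\mathcal{A}$ has as domain the partial computable functions $\psi:\omega\to A$ with $C\subseteq^*\mathrm{dom}(\psi)$, modulo $\psi_1=_C\psi_2$ iff $C\subseteq^*\{i:\psi_1(i)\downarrow=\psi_2(i)\downarrow\}$, with $f([\psi])=[f\circ\psi]$. -}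

module Defs where

open import Data.Nat using (ℕ; zero; suc; _<_)
open import Data.Nat.Properties using (<-cmp)
open import Data.Fin using (Fin)
import Data.Fin as Fin
open import Data.Vec using (Vec; []; _∷_; lookup; tabulate)
open import Data.Vec.Properties using (tabulate-cong)
open import Data.Bool using (Bool; true; false; T; if_then_else_)
open import Data.List using (List)
open import Data.List.Membership.Propositional using (_∈_)
open import Data.List.Relation.Unary.Any using (Any)
open import Data.Product using (Σ; ∃; _×_; _,_; proj₁; proj₂)
open import Data.Sum using (_⊎_)
open import Data.Empty using (⊥; ⊥-elim)
open import Relation.Nullary using (¬_)
open import Relation.Binary using (Tri; tri<; tri≈; tri>)
open import Relation.Binary.PropositionalEquality using (_≡_; refl; sym; subst)

-- Model of computation: (partial) μ-recursive functions.
-- A code of arity n denotes a partial function ℕⁿ ⇀ ℕ.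

data PR : ℕ → Set where
  zer  : ∀ {n} → PR n
  succ : PR 1
  proj : ∀ {n} → Fin n → PR n
  comp : ∀ {m n} → PR m → (Fin m → PR n) → PR n
  prec : ∀ {n} → PR n → PR (suc (suc n)) → PR (suc n)
  mu   : ∀ {n} → PR (suc n) → PR n

data Eval : {n : ℕ} → PR n → Vec ℕ n → ℕ → Set where
  e-zer  : ∀ {n} {xs : Vec ℕ n} → Eval (zer {n}) xs 0
  e-succ : ∀ {x} → Eval succ (x ∷ []) (suc x)
  e-proj : ∀ {n} {i : Fin n} {xs : Vec ℕ n} → Eval (proj i) xs (lookup xs i)
  e-comp : ∀ {m n} {f : PR m} {gs : Fin m → PR n} {xs : Vec ℕ n} {z : ℕ}
           (ys : Fin m → ℕ) → (∀ j → Eval (gs j) xs (ys j)) →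
           Eval f (tabulate ys) z → Eval (comp f gs) xs z
  e-prec0 : ∀ {n} {g : PR n} {h : PR (suc (suc n))} {xs : Vec ℕ n} {z : ℕ} →
            Eval g xs z → Eval (prec g h) (0 ∷ xs) z
  e-precS : ∀ {n} {g : PR n} {h : PR (suc (suc n))} {xs : Vec ℕ n} {y r z : ℕ} →
            Eval (prec g h) (y ∷ xs) r → Eval h (y ∷ r ∷ xs) z →
            Eval (prec g h) (suc y ∷ xs) z
  e-mu : ∀ {n} {f : PR (suc n)} {xs : Vec ℕ n} {y : ℕ} →
         Eval f (y ∷ xs) 0 →
         (∀ z → z < y → Σ ℕ λ k → Eval f (z ∷ xs) (suc k)) →
         Eval (mu f) xs y

Eval-det : ∀ {n} {p : PR n} {xs : Vec ℕ n} {a b : ℕ} → Eval p xs a → Eval p xs b → a ≡ b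
Eval-det e-zer e-zer = refl
Eval-det e-succ e-succ = refl
Eval-det e-proj e-proj = refl
Eval-det (e-comp {f = f} {z = z} ys ev ef) (e-comp ys' ev' ef') =
  Eval-det ef (subst (λ w → Eval f w _) (sym (tabulate-cong (λ j → Eval-det (ev j) (ev' j)))) ef')
Eval-det (e-prec0 a) (e-prec0 b) = Eval-det a b
Eval-det (e-precS a h) (e-precS a' h') with Eval-det a a'
... | refl = Eval-det h h'
Eval-det (e-mu {y = y} z0 lt) (e-mu {y = y'} z0' lt') with <-cmp y y'
... | tri< p _ _ = ⊥-elim (helper (lt' y p))
  where helper : Σ ℕ (λ k → Eval _ _ (suc k)) → ⊥
        helper (k , ev) with Eval-det z0 ev
        ... | ()
... | tri≈ _ e _ = e
... | tri> _ _ p = ⊥-elim (helper (lt y' p))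
  where helper : Σ ℕ (λ k → Eval _ _ (suc k)) → ⊥
        helper (k , ev) with Eval-det z0' ev
        ... | ()

_·_⇓_ : PR 1 → ℕ → ℕ → Set
ψ · i ⇓ v = Eval ψ (i ∷ []) v

Dom : PR 1 → ℕ → Set
Dom ψ i = ∃ λ v → ψ · i ⇓ v

W : PR 1 → ℕ → Set
W e = Dom e

Finite : (ℕ → Set) → Set
Finite P = ∃ λ (L : List ℕ) → ∀ i → P i → i ∈ L

Infinite : (ℕ → Set) → Set
Infinite P = ¬ Finite P

_⊆*_ : (ℕ → Set) → (ℕ → Set) → Set
X ⊆* Y = Finite (λ i → X i × ¬ Y i)

Cohesive : (ℕ → Set) → Set
Cohesive C = Infinite C ×
  (∀ (e : PR 1) → Finite (λ i → W e i × C i) ⊎ Finite (λ i → ¬ W e i × C i))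

record Str : Set₁ where
  field
    Carrier : Set
    _≈_     : Carrier → Carrier → Set
    F       : Carrier → Carrier

module _ (S : Str) where
  open Str S

  iter : ℕ → Carrier → Carrier
  iter zero x = x
  iter (suc n) x = F (iter n x)

  Orbit : Carrier → Carrier → Set
  Orbit a b = ∃ λ n → (iter n a ≈ b) ⊎ (iter n b ≈ a)

  FiniteS : (Carrier → Set) → Set
  FiniteS P = ∃ λ (L : List Carrier) → ∀ x → P x → Any (λ y → x ≈ y) L

  InfiniteOrbit : Carrier → Set
  InfiniteOrbit a = ¬ FiniteS (Orbit a)

  HasInfiniteOrbit : Set
  HasInfiniteOrbit = ∃ λ a → InfiniteOrbit a

  InRange : Carrier → Set
  InRange b = ∃ λ c → F c ≈ b

  ZOrbit : Carrier → Set
  ZOrbit a = InfiniteOrbit a × (∀ b → Orbit a b → InRange b)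

  FinitelyManyZOrbits : Set
  FinitelyManyZOrbits =
    ∃ λ (L : List Carrier) → ∀ a → ZOrbit a → Any (λ c → Orbit c a) L

  InfinitelyManyZOrbits : Set
  InfinitelyManyZOrbits = ¬ FinitelyManyZOrbits

Iso : Str → Str → Set
Iso S₁ S₂ =
  Σ (S₁.Carrier → S₂.Carrier) λ h →
    (∀ x y → x ≈₁ y → h x ≈₂ h y) ×
    (∀ x y → h x ≈₂ h y → x ≈₁ y) ×
    (∀ y → ∃ λ x → h x ≈₂ y) ×
    (∀ x → h (S₁.F x) ≈₂ S₂.F (h x))
  where
    module S₁ = Str S₁
    module S₂ = Str S₂
    _≈₁_ = S₁._≈_
    _≈₂_ = S₂._≈_

-- Computable injection structures (A ⊆ ω computable, f : A → A computable,
-- one-to-one).  f is given as a map on ω; only its restriction to A matters.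

record CompInj : Set where
  field
    A        : ℕ → Bool
    f        : ℕ → ℕ
    nonempty : ∃ λ a → T (A a)
    f-into   : ∀ a → T (A a) → T (A (f a))
    f-inj    : ∀ a b → T (A a) → T (A b) → f a ≡ f b → a ≡ b
    A-comp   : Σ (PR 1) λ e → ∀ x → e · x ⇓ (if A x then 1 else 0)
    f-comp   : Σ (PR 1) λ e → ∀ a → T (A a) → e · a ⇓ f a

module _ (𝒜 : CompInj) where
  open CompInj 𝒜

  asStr : Str
  asStr = record
    { Carrier = Σ ℕ (λ a → T (A a))
    ; _≈_ = λ x y → proj₁ x ≡ proj₁ y
    ; F = λ x → f (proj₁ x) , f-into (proj₁ x) (proj₂ x)
    }

  -- Elements of the cohesive power: partial computable ψ : ω ⇀ A with C ⊆* dom ψ.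
  record PElem (C : ℕ → Set) : Set where
    constructor pelem
    field
      ψ    : PR 1
      into : ∀ i v → ψ · i ⇓ v → T (A v)
      dom  : C ⊆* Dom ψ

  fcode : PR 1
  fcode = proj₁ f-comp

  fψ : PR 1 → PR 1
  fψ ψ = comp fcode (λ _ → ψ)

  fψ-into : ∀ ψ → (∀ i v → ψ · i ⇓ v → T (A v)) → ∀ i v → fψ ψ · i ⇓ v → T (A v)
  fψ-into ψ into i v (e-comp ys ev ef) =
    subst (λ w → T (A w)) (Eval-det (proj₂ f-comp (ys Fin.zero) a0) ef) (f-into _ a0)
    where a0 = into i (ys Fin.zero) (ev Fin.zero)

  fψ-dom : ∀ C ψ → (∀ i v → ψ · i ⇓ v → T (A v)) → C ⊆* Dom ψ → C ⊆* Dom (fψ ψ)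
  fψ-dom C ψ into (L , h) = L , λ i (ci , nd) → h i (ci , λ { (v , ev) →
    nd (f v , e-comp (λ _ → v) (λ _ → ev) (proj₂ f-comp v (into i v ev))) })

  CohPow : (C : ℕ → Set) → Str
  CohPow C = record
    { Carrier = PElem C
    ; _≈_ = λ p q → C ⊆* (λ i → ∃ λ v → (PElem.ψ p · i ⇓ v) × (PElem.ψ q · i ⇓ v))
    ; F = λ p → pelem (fψ (PElem.ψ p)) (fψ-into (PElem.ψ p) (PElem.into p))
                      (fψ-dom C (PElem.ψ p) (PElem.into p) (PElem.dom p))
    }

-- Fix a in an infinite orbit of 𝒜; then g n = fⁿ(a) is an injective computable
-- sequence. Say that p ∈ ∏_C 𝒜 traces the line of slope m and offset d with lag e
-- if f^e (p i) = g (d + i m) for almost all i ∈ C. Applying f raises d by one and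
-- undoing it raises e by one, so the slope is constant along orbits; and since two
-- affine functions agreeing on the infinite set C coincide, the slope of p is
-- unique. Hence the elements [i ↦ g (i (k + 1))] lie in pairwise distinct orbits,
-- each orbit is infinite, and it is a Z-orbit because an element of positive slope
-- has the predecessor [i ↦ g (d + i m ∸ (e + 1))].
-- Cohesiveness of C is only used through the infinitude of C.

module Submission where

open import Defs
open import Data.Nat using (ℕ; zero; suc; _+_; _*_; _∸_; _<_; _≤_; s≤s; pred)
open import Data.Nat.Properties
open import Data.Nat.DivMod using (_%_; _/_; m≡m%n+[m/n]*n; m%n<n)
open import Data.Fin using (Fin; toℕ)
import Data.Fin as Fin
open import Data.Fin.Properties using (pigeonhole)
open import Data.Vec using ([])
open import Data.Bool using (T)
open import Data.List using (List; []; _++_; length; lookup; upTo; map)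
open import Data.List.Membership.Propositional.Properties using (∈-++⁺ˡ; ∈-++⁺ʳ; ∈-upTo⁺)
open import Data.List.Membership.DecPropositional _≟_ using (_∈?_)
open import Data.List.Relation.Unary.Any using (Any; index)
import Data.List.Relation.Unary.Any as Any
open import Data.List.Relation.Unary.Any.Properties using (lookup-index; map⁺)
open import Data.Product using (∃; ∃₂; _×_; _,_; proj₁; proj₂)
open import Data.Sum using (inj₁; inj₂; swap)
open import Data.Empty using (⊥-elim)
open import Relation.Nullary using (¬_)
open import Relation.Nullary.Decidable using (decidable-stable)
open import Relation.Binary using (tri<; tri≈; tri>)
open import Relation.Binary.PropositionalEquality
  using (_≡_; _≢_; refl; sym; trans; cong; subst; module ≡-Reasoning)

module _ {C : ℕ → Set} where

  ⊆*-all : ∀ {P} → (∀ i → P i) → C ⊆* P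
  ⊆*-all p = [] , λ i (_ , ¬p) → ⊥-elim (¬p (p i))

  ⊆*-≥ : ∀ n → C ⊆* (n ≤_)
  ⊆*-≥ n = upTo n , λ i (_ , n≰i) → ∈-upTo⁺ (≰⇒> n≰i)

  ⊆*-map₂ : ∀ {P Q R} → C ⊆* P → C ⊆* Q → (∀ {i} → P i → Q i → R i) → C ⊆* R
  ⊆*-map₂ (L₁ , cov₁) (L₂ , cov₂) pq⇒r = L₁ ++ L₂ , λ i (ci , ¬r) →
    decidable-stable (i ∈? L₁ ++ L₂) λ i∉ →
      i∉ (∈-++⁺ʳ L₁ (cov₂ i (ci , λ q →
        i∉ (∈-++⁺ˡ (cov₁ i (ci , λ p → ¬r (pq⇒r p q)))))))

  ⊆*-map : ∀ {P Q} → C ⊆* P → (∀ {i} → P i → Q i) → C ⊆* Q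
  ⊆*-map c p⇒q = ⊆*-map₂ c c λ p _ → p⇒q p

  Infinite-⊆*⇒¬Finite : ∀ {P} → Infinite C → C ⊆* P → ¬ Finite P
  Infinite-⊆*⇒¬Finite C-inf (L₁ , cov₁) (L₂ , cov₂) = C-inf (L₁ ++ L₂ , λ i ci →
    decidable-stable (i ∈? L₁ ++ L₂) λ i∉ →
      i∉ (∈-++⁺ˡ (cov₁ i (ci , λ p → i∉ (∈-++⁺ʳ L₁ (cov₂ i p))))))

affine-≡⇒≤ : ∀ {a b m m′ i} → m < m′ → a + i * m ≡ b + i * m′ → i ≤ a
affine-≡⇒≤ {a} {b} {m} {m′} {i} m<m′ eq = +-cancelʳ-≤ (i * m) i a (begin
  i + i * m  ≡⟨ sym (*-suc i m) ⟩
  i * suc m  ≤⟨ *-monoʳ-≤ i m<m′ ⟩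
  i * m′     ≤⟨ m≤n+m (i * m′) b ⟩
  b + i * m′ ≡⟨ sym eq ⟩
  a + i * m  ∎)
  where open ≤-Reasoning

affine-unique : ∀ {C : ℕ → Set} {a b m m′} → Infinite C →
  C ⊆* (λ i → a + i * m ≡ b + i * m′) → m ≡ m′ × a ≡ b
affine-unique {C} {a} {b} {m} {m′} C-inf agree with <-cmp m m′
... | tri< m<m′ _ _ = ⊥-elim (Infinite-⊆*⇒¬Finite C-inf agree
      (upTo (suc a) , λ i eq → ∈-upTo⁺ (s≤s (affine-≡⇒≤ m<m′ eq))))
... | tri> _ _ m′<m = ⊥-elim (Infinite-⊆*⇒¬Finite C-inf agree
      (upTo (suc b) , λ i eq → ∈-upTo⁺ (s≤s (affine-≡⇒≤ m′<m (sym eq)))))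
... | tri≈ _ refl _ = refl , decidable-stable (a ≟ b) λ a≢b →
      Infinite-⊆*⇒¬Finite C-inf agree ([] , λ i eq → ⊥-elim (a≢b (+-cancelʳ-≡ (i * m) a b eq)))

no-injection-into-list : ∀ {Y : Set} (R : ℕ → Y → Set) (L : List Y) →
  (∀ {m n y} → R m y → R n y → m ≡ n) → ¬ (∀ n → Any (R n) L)
no-injection-into-list R L R-injective cover
  with i , j , i<j , same ← pigeonhole ≤-refl (λ (i : Fin (suc (length L))) → index (cover (toℕ i)))
  = <⇒≢ i<j (R-injective (lookup-index (cover (toℕ i)))
      (subst (λ k → R (toℕ j) (lookup L k)) (sym same) (lookup-index (cover (toℕ j)))))

_∘C_ : PR 1 → PR 1 → PR 1
c ∘C d = comp c (λ _ → d)

∘C-⇓ : ∀ {c d i x y} → d · i ⇓ x → c · x ⇓ y → (c ∘C d) · i ⇓ y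
∘C-⇓ {x = x} d⇓ c⇓ = e-comp (λ _ → x) (λ _ → d⇓) c⇓

∘C-⇓⁻ : ∀ {c d i y} → (c ∘C d) · i ⇓ y → ∃ λ x → d · i ⇓ x × c · x ⇓ y
∘C-⇓⁻ (e-comp xs d⇓ c⇓) = xs Fin.zero , d⇓ Fin.zero , c⇓

constC : ℕ → PR 0
constC zero = zer
constC (suc n) = comp succ (λ _ → constC n)

constC-⇓ : ∀ n → Eval (constC n) [] n
constC-⇓ zero = e-zer
constC-⇓ (suc n) = e-comp (λ _ → n) (λ _ → constC-⇓ n) e-succ

addC : ℕ → PR 1
addC zero = proj Fin.zero
addC (suc m) = succ ∘C addC m

addC-⇓ : ∀ m x → addC m · x ⇓ (m + x)
addC-⇓ zero x = e-proj
addC-⇓ (suc m) x = ∘C-⇓ (addC-⇓ m x) e-succ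

mulC : ℕ → PR 1
mulC m = prec zer (comp (addC m) (λ _ → proj (Fin.suc Fin.zero)))

mulC-⇓ : ∀ m i → mulC m · i ⇓ (i * m)
mulC-⇓ m zero = e-prec0 e-zer
mulC-⇓ m (suc i) = e-precS (mulC-⇓ m i) (e-comp (λ _ → i * m) (λ _ → e-proj) (addC-⇓ m (i * m)))

predC : PR 1
predC = prec zer (proj Fin.zero)

predC-⇓ : ∀ x → predC · x ⇓ pred x
predC-⇓ zero = e-prec0 e-zer
predC-⇓ (suc x) = e-precS (predC-⇓ x) e-proj

monusC : ℕ → PR 1
monusC zero = proj Fin.zero
monusC (suc n) = predC ∘C monusC n

monusC-⇓ : ∀ n x → monusC n · x ⇓ (x ∸ n)
monusC-⇓ zero x = e-proj
monusC-⇓ (suc n) x =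
  subst (monusC (suc n) · x ⇓_) (pred[m∸n]≡m∸[1+n] x n) (∘C-⇓ (monusC-⇓ n x) (predC-⇓ (x ∸ n)))

module Iterates (𝒜 : CompInj) where
  open CompInj 𝒜

  S𝒜 : Str
  S𝒜 = asStr 𝒜

  fⁿ : ℕ → ℕ → ℕ
  fⁿ zero v = v
  fⁿ (suc n) v = f (fⁿ n v)

  fⁿ-+ : ∀ m n v → fⁿ m (fⁿ n v) ≡ fⁿ (m + n) v
  fⁿ-+ zero n v = refl
  fⁿ-+ (suc m) n v = cong f (fⁿ-+ m n v)

  fⁿ-f : ∀ n v → fⁿ n (f v) ≡ f (fⁿ n v)
  fⁿ-f zero v = refl
  fⁿ-f (suc n) v = cong f (fⁿ-f n v)

  fⁿ-into : ∀ n {v} → T (A v) → T (A (fⁿ n v))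
  fⁿ-into zero v∈A = v∈A
  fⁿ-into (suc n) v∈A = f-into _ (fⁿ-into n v∈A)

  fⁿ-injective : ∀ n {v w} → T (A v) → T (A w) → fⁿ n v ≡ fⁿ n w → v ≡ w
  fⁿ-injective zero _ _ eq = eq
  fⁿ-injective (suc n) v∈A w∈A eq =
    fⁿ-injective n v∈A w∈A (f-inj _ _ (fⁿ-into n v∈A) (fⁿ-into n w∈A) eq)

  iter-fⁿ : ∀ n x → proj₁ (iter S𝒜 n x) ≡ fⁿ n (proj₁ x)
  iter-fⁿ zero x = refl
  iter-fⁿ (suc n) x = cong f (iter-fⁿ n x)

  module Periodic (x : Str.Carrier S𝒜) (p : ℕ) (periodic : fⁿ (suc p) (proj₁ x) ≡ proj₁ x) where
    a : ℕ
    a = proj₁ x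

    P : ℕ
    P = suc p

    fⁿ-multiple : ∀ q → fⁿ (q * P) a ≡ a
    fⁿ-multiple zero = refl
    fⁿ-multiple (suc q) = begin
      fⁿ (P + q * P) a    ≡⟨ sym (fⁿ-+ P (q * P) a) ⟩
      fⁿ P (fⁿ (q * P) a) ≡⟨ cong (fⁿ P) (fⁿ-multiple q) ⟩
      fⁿ P a              ≡⟨ periodic ⟩
      a                   ∎
      where open ≡-Reasoning

    fⁿ-mod : ∀ n → fⁿ n a ≡ fⁿ (n % P) a
    fⁿ-mod n = begin
      fⁿ n a                          ≡⟨ cong (λ k → fⁿ k a) (m≡m%n+[m/n]*n n P) ⟩
      fⁿ (n % P + (n / P) * P) a      ≡⟨ sym (fⁿ-+ (n % P) _ a) ⟩
      fⁿ (n % P) (fⁿ ((n / P) * P) a) ≡⟨ cong (fⁿ (n % P)) (fⁿ-multiple (n / P)) ⟩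
      fⁿ (n % P) a                    ∎
      where open ≡-Reasoning

    fⁿ-back : ∀ n {b} → T (A b) → fⁿ n b ≡ a → b ≡ fⁿ (n * P ∸ n) a
    fⁿ-back n {b} b∈A eq = fⁿ-injective n b∈A (fⁿ-into (n * P ∸ n) (proj₂ x)) (begin
      fⁿ n b                  ≡⟨ eq ⟩
      a                       ≡⟨ sym (fⁿ-multiple n) ⟩
      fⁿ (n * P) a            ≡⟨ cong (λ k → fⁿ k a) (sym (m+[n∸m]≡n (m≤m*n n P))) ⟩
      fⁿ (n + (n * P ∸ n)) a  ≡⟨ sym (fⁿ-+ n _ a) ⟩
      fⁿ n (fⁿ (n * P ∸ n) a) ∎)
      where open ≡-Reasoning

    cycle : List (Str.Carrier S𝒜)
    cycle = map (λ j → fⁿ j a , fⁿ-into j (proj₂ x)) (upTo P)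

    ∈-cycle : ∀ {b} n → b ≡ fⁿ n a → Any (λ y → b ≡ proj₁ y) cycle
    ∈-cycle n eq = map⁺ (Any.map (λ { refl → trans eq (fⁿ-mod n) }) (∈-upTo⁺ (m%n<n n P)))

    orbit-finite : FiniteS S𝒜 (Orbit S𝒜 x)
    orbit-finite = cycle , λ where
      y (n , inj₁ eq) → ∈-cycle n (trans (sym eq) (iter-fⁿ n x))
      y (n , inj₂ eq) → ∈-cycle (n * P ∸ n) (fⁿ-back n (proj₂ y) (trans (sym (iter-fⁿ n y)) eq))

  module _ {x : Str.Carrier S𝒜} (x-inf : InfiniteOrbit S𝒜 x) where
    private
      a : ℕ
      a = proj₁ x

    fⁿ-<-≢ : ∀ {m n} → m < n → fⁿ m a ≢ fⁿ n a
    fⁿ-<-≢ {m} m<n eq with k , refl ← m≤n⇒∃[o]m+o≡n m<n =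
      x-inf (Periodic.orbit-finite x k (sym (fⁿ-injective m (proj₂ x) (fⁿ-into (suc k) (proj₂ x)) (begin
        fⁿ m a              ≡⟨ eq ⟩
        fⁿ (suc m + k) a    ≡⟨ cong (λ n → fⁿ n a) (sym (+-suc m k)) ⟩
        fⁿ (m + suc k) a    ≡⟨ sym (fⁿ-+ m (suc k) a) ⟩
        fⁿ m (fⁿ (suc k) a) ∎))))
      where open ≡-Reasoning

    infinite-orbit⇒fⁿ-injective : ∀ {m n} → fⁿ m a ≡ fⁿ n a → m ≡ n
    infinite-orbit⇒fⁿ-injective {m} {n} eq with <-cmp m n
    ... | tri< m<n _ _ = ⊥-elim (fⁿ-<-≢ m<n eq)
    ... | tri≈ _ m≡n _ = m≡n
    ... | tri> _ _ n<m = ⊥-elim (fⁿ-<-≢ n<m (sym eq))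

module CohesivePower (𝒜 : CompInj) (C : ℕ → Set) (C-inf : Infinite C) where
  open CompInj 𝒜
  open Iterates 𝒜
  open PElem

  B : Str
  B = CohPow 𝒜 C

  open Str B using () renaming (Carrier to El; _≈_ to _≈B_; F to FB)

  ≈B-refl : ∀ p → p ≈B p
  ≈B-refl p = ⊆*-map (dom p) λ (v , p⇓) → v , p⇓ , p⇓

  ≈B-sym : ∀ {p q} → p ≈B q → q ≈B p
  ≈B-sym p≈q = ⊆*-map p≈q λ (v , p⇓ , q⇓) → v , q⇓ , p⇓

  ≈B-trans : ∀ {p q r} → p ≈B q → q ≈B r → p ≈B r
  ≈B-trans {r = r} p≈q q≈r = ⊆*-map₂ p≈q q≈r λ (v , p⇓ , q⇓) (w , q⇓′ , r⇓) →
    v , p⇓ , subst (ψ r · _ ⇓_) (Eval-det q⇓′ q⇓) r⇓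

  FB-⇓ : ∀ p {i v} → ψ p · i ⇓ v → ψ (FB p) · i ⇓ f v
  FB-⇓ p {i} {v} p⇓ = ∘C-⇓ p⇓ (proj₂ f-comp v (into p i v p⇓))

  FB-⇓⁻ : ∀ p {i w} → ψ (FB p) · i ⇓ w → ∃ λ v → ψ p · i ⇓ v × w ≡ f v
  FB-⇓⁻ p {i} Fp⇓ with v , p⇓ , f⇓ ← ∘C-⇓⁻ Fp⇓ =
    v , p⇓ , Eval-det f⇓ (proj₂ f-comp v (into p i v p⇓))

  FB-cong : ∀ {p q} → p ≈B q → FB p ≈B FB q
  FB-cong {p} {q} p≈q = ⊆*-map p≈q λ (v , p⇓ , q⇓) → f v , FB-⇓ p p⇓ , FB-⇓ q q⇓

  idIso : Iso B B
  idIso = (λ p → p) , (λ _ _ p≈q → p≈q) , (λ _ _ p≈q → p≈q) ,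
          (λ p → p , ≈B-refl p) , (λ p → ≈B-refl (FB p))

  module Lines (a : ℕ) (a∈A : T (A a)) (a-inf : InfiniteOrbit S𝒜 (a , a∈A)) where

    g : ℕ → ℕ
    g n = fⁿ n a

    g-injective : ∀ {m n} → g m ≡ g n → m ≡ n
    g-injective = infinite-orbit⇒fⁿ-injective a-inf

    gC : PR 1
    gC = prec (constC a) (comp (proj₁ f-comp) (λ _ → proj (Fin.suc Fin.zero)))

    gC-⇓ : ∀ n → gC · n ⇓ g n
    gC-⇓ zero = e-prec0 (constC-⇓ a)
    gC-⇓ (suc n) = e-precS (gC-⇓ n)
      (e-comp (λ _ → g n) (λ _ → e-proj) (proj₂ f-comp (g n) (fⁿ-into n a∈A)))

    along : (c : PR 1) (j : ℕ → ℕ) → (∀ i → c · i ⇓ j i) → El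
    along c j c⇓ = pelem (gC ∘C c) into-A (⊆*-all λ i → _ , ∘C-⇓ (c⇓ i) (gC-⇓ (j i)))
      where
      into-A : ∀ i v → (gC ∘C c) · i ⇓ v → T (A v)
      into-A i v ⇓v with x , _ , gC⇓ ← ∘C-⇓⁻ ⇓v =
        subst (λ w → T (A w)) (Eval-det (gC-⇓ x) gC⇓) (fⁿ-into x a∈A)

    along-⇓ : ∀ c j c⇓ i → ψ (along c j c⇓) · i ⇓ g (j i)
    along-⇓ c j c⇓ i = ∘C-⇓ (c⇓ i) (gC-⇓ (j i))

    -- A record rather than a synonym, so that p, m, d and e are inferable.
    record Traces (p : El) (m d e : ℕ) : Set where
      constructor traces
      field agree : C ⊆* λ i → ∃ λ v → ψ p · i ⇓ v × fⁿ e v ≡ g (d + i * m)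

    Traces-resp-≈ : ∀ {p q m d e} → p ≈B q → Traces p m d e → Traces q m d e
    Traces-resp-≈ {e = e} p≈q (traces t) = traces (⊆*-map₂ p≈q t
      λ (v , p⇓ , q⇓) (w , p⇓′ , eq) → v , q⇓ , trans (cong (fⁿ e) (Eval-det p⇓ p⇓′)) eq)

    Traces-resp-≈˘ : ∀ {p q m d e} → q ≈B p → Traces p m d e → Traces q m d e
    Traces-resp-≈˘ {p} {q} q≈p = Traces-resp-≈ (≈B-sym {q} {p} q≈p)

    Traces-FB : ∀ {p m d e} → Traces p m d e → Traces (FB p) m (suc d) e
    Traces-FB {p} {e = e} (traces t) = traces (⊆*-map t
      λ (v , p⇓ , eq) → f v , FB-⇓ p p⇓ , trans (fⁿ-f e v) (cong f eq))

    Traces-FB⁻ : ∀ {p m d e} → Traces (FB p) m d e → Traces p m d (suc e)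
    Traces-FB⁻ {p} {e = e} (traces t) = traces (⊆*-map t λ (w , Fp⇓ , eq) → unshift Fp⇓ eq)
      where
      unshift : ∀ {i w u} → ψ (FB p) · i ⇓ w → fⁿ e w ≡ u →
        ∃ λ v → ψ p · i ⇓ v × fⁿ (suc e) v ≡ u
      unshift Fp⇓ eq with v , p⇓ , refl ← FB-⇓⁻ p Fp⇓ = v , p⇓ , trans (sym (fⁿ-f e v)) eq

    -- Both traces give f^(e+e′)(p i) = g(e′ + d + i m) = g(e + d′ + i m′) for almost all i.
    Traces-unique : ∀ {p m d e m′ d′ e′} → Traces p m d e → Traces p m′ d′ e′ →
      m ≡ m′ × e′ + d ≡ e + d′
    Traces-unique {p} {m} {d} {e} {m′} {d′} {e′} (traces t) (traces t′) =
      affine-unique C-inf (⊆*-map₂ t t′ lines-meet)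
      where
      lines-meet : ∀ {i} → (∃ λ v → ψ p · i ⇓ v × fⁿ e v ≡ g (d + i * m)) →
        (∃ λ v → ψ p · i ⇓ v × fⁿ e′ v ≡ g (d′ + i * m′)) →
        e′ + d + i * m ≡ e + d′ + i * m′
      lines-meet {i} (v , p⇓ , eq) (w , p⇓′ , eq′) with refl ← Eval-det p⇓ p⇓′ =
        trans (+-assoc e′ d (i * m)) (trans (g-injective (begin
          g (e′ + (d + i * m))   ≡⟨ sym (fⁿ-+ e′ _ a) ⟩
          fⁿ e′ (g (d + i * m))  ≡⟨ cong (fⁿ e′) (sym eq) ⟩
          fⁿ e′ (fⁿ e v)         ≡⟨ fⁿ-+ e′ e v ⟩
          fⁿ (e′ + e) v          ≡⟨ cong (λ k → fⁿ k v) (+-comm e′ e) ⟩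
          fⁿ (e + e′) v          ≡⟨ sym (fⁿ-+ e e′ v) ⟩
          fⁿ e (fⁿ e′ v)         ≡⟨ cong (fⁿ e) eq′ ⟩
          fⁿ e (g (d′ + i * m′)) ≡⟨ fⁿ-+ e _ a ⟩
          g (e + (d′ + i * m′))  ∎)) (sym (+-assoc e d′ (i * m′))))
        where open ≡-Reasoning

    line : ℕ → El
    line k = along (mulC (suc k)) (_* suc k) (mulC-⇓ (suc k))

    Traces-line : ∀ k → Traces (line k) (suc k) 0 0
    Traces-line k = traces (⊆*-all λ i → _ , along-⇓ _ _ (mulC-⇓ (suc k)) i , refl)

    -- The slope makes d + i (k + 1) ≥ e + 1 for i ≥ e + 1, so the truncated subtraction in j is exact there.
    Traces⇒InRange : ∀ {q k d e} → Traces q (suc k) d e → InRange B q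
    Traces⇒InRange {q} {k} {d} {e} (traces t) = r , ⊆*-map₂ (⊆*-≥ (suc e)) t meets
      where
      j : ℕ → ℕ
      j i = d + i * suc k ∸ suc e
      j⇓ : ∀ i → (monusC (suc e) ∘C (addC d ∘C mulC (suc k))) · i ⇓ j i
      j⇓ i = ∘C-⇓ (∘C-⇓ (mulC-⇓ (suc k) i) (addC-⇓ d (i * suc k))) (monusC-⇓ (suc e) _)
      r : El
      r = along _ j j⇓
      meets : ∀ {i} → suc e ≤ i → (∃ λ v → ψ q · i ⇓ v × fⁿ e v ≡ g (d + i * suc k)) →
        ∃ λ w → ψ (FB r) · i ⇓ w × ψ q · i ⇓ w
      meets {i} e<i (v , q⇓ , eq) =
        v , subst (ψ (FB r) · i ⇓_) g[1+j]≡v (FB-⇓ r (along-⇓ _ j j⇓ i)) , q⇓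
        where
        e<line : suc e ≤ d + i * suc k
        e<line = ≤-trans e<i (≤-trans (m≤m*n i (suc k)) (m≤n+m (i * suc k) d))
        g[1+j]≡v : g (suc (j i)) ≡ v
        g[1+j]≡v = fⁿ-injective e (fⁿ-into (suc (j i)) a∈A) (into q i v q⇓) (begin
          fⁿ e (g (suc (j i)))  ≡⟨ fⁿ-+ e (suc (j i)) a ⟩
          g (e + suc (j i))     ≡⟨ cong g (trans (+-suc e (j i)) (m+[n∸m]≡n e<line)) ⟩
          g (d + i * suc k)     ≡⟨ sym eq ⟩
          fⁿ e v                ∎)
          where open ≡-Reasoning

    module Transfer (S : Str) (iso : Iso S B) where
      open Str S using () renaming (Carrier to Car; _≈_ to _≈S_)

      h : Car → El
      h = proj₁ iso

      h-cong : ∀ {z y} → z ≈S y → h z ≈B h y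
      h-cong = proj₁ (proj₂ iso) _ _

      h-reflects : ∀ {z y} → h z ≈B h y → z ≈S y
      h-reflects = proj₁ (proj₂ (proj₂ iso)) _ _

      h-surjective : ∀ p → ∃ λ z → h z ≈B p
      h-surjective = proj₁ (proj₂ (proj₂ (proj₂ iso)))

      h-F : ∀ z → h (Str.F S z) ≈B FB (h z)
      h-F = proj₂ (proj₂ (proj₂ (proj₂ iso)))

      ≈S-refl : ∀ z → z ≈S z
      ≈S-refl z = h-reflects (≈B-refl (h z))

      Traces-h-cong : ∀ {z y m d e} → z ≈S y → Traces (h z) m d e → Traces (h y) m d e
      Traces-h-cong {z} {y} z≈y = Traces-resp-≈ {h z} {h y} (h-cong z≈y)

      Traces-h-cong˘ : ∀ {z y m d e} → y ≈S z → Traces (h z) m d e → Traces (h y) m d e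
      Traces-h-cong˘ {z} {y} y≈z = Traces-resp-≈˘ {h z} {h y} (h-cong y≈z)

      HasSlope : Car → ℕ → Set
      HasSlope z m = ∃₂ λ d e → Traces (h z) m d e

      Traces-iter : ∀ n {z m d e} → Traces (h z) m d e → Traces (h (iter S n z)) m (n + d) e
      Traces-iter zero t = t
      Traces-iter (suc n) {z} t = Traces-resp-≈˘ (h-F (iter S n z)) (Traces-FB (Traces-iter n t))

      Traces-iter⁻ : ∀ n {z m d e} → Traces (h (iter S n z)) m d e → Traces (h z) m d (n + e)
      Traces-iter⁻ zero t = t
      Traces-iter⁻ (suc n) {z} {e = e} t = subst (Traces (h z) _ _) (+-suc n e)
        (Traces-iter⁻ n (Traces-FB⁻ (Traces-resp-≈ (h-F (iter S n z)) t)))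

      HasSlope-orbit : ∀ {z y m} → Orbit S z y → HasSlope z m → HasSlope y m
      HasSlope-orbit (n , inj₁ eq) (d , e , t) = n + d , e , Traces-h-cong eq (Traces-iter n t)
      HasSlope-orbit (n , inj₂ eq) (d , e , t) = d , n + e , Traces-iter⁻ n (Traces-h-cong˘ eq t)

      HasSlope-unique : ∀ {z m m′} → HasSlope z m → HasSlope z m′ → m ≡ m′
      HasSlope-unique (_ , _ , t) (_ , _ , t′) = proj₁ (Traces-unique t t′)

      lineS : ℕ → Car
      lineS k = proj₁ (h-surjective (line k))

      Traces-lineS : ∀ k → Traces (h (lineS k)) (suc k) 0 0
      Traces-lineS k = Traces-resp-≈˘ (proj₂ (h-surjective (line k))) (Traces-line k)

      iter-lineS-injective : ∀ k {m n y} → iter S m (lineS k) ≈S y → iter S n (lineS k) ≈S y → m ≡ n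
      iter-lineS-injective k {m} {n} eq eq′ = +-cancelʳ-≡ 0 m n (proj₂ (Traces-unique
        (Traces-h-cong eq (Traces-iter m (Traces-lineS k)))
        (Traces-h-cong eq′ (Traces-iter n (Traces-lineS k)))))

      lineS-ZOrbit : ∀ k → ZOrbit S (lineS k)
      lineS-ZOrbit k = orbit-infinite , orbit-in-range
        where
        orbit-infinite : InfiniteOrbit S (lineS k)
        orbit-infinite (L , cover) = no-injection-into-list (λ n y → iter S n (lineS k) ≈S y) L
          (iter-lineS-injective k) (λ n → cover _ (n , inj₁ (≈S-refl _)))
        orbit-in-range : ∀ y → Orbit S (lineS k) y → InRange S y
        orbit-in-range y o
          with d , e , t ← HasSlope-orbit o (0 , 0 , Traces-lineS k)
          with r , Fr≈hy ← Traces⇒InRange t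
          with c , hc≈r ← h-surjective r
          = c , h-reflects (≈B-trans {h (Str.F S c)} {FB (h c)} {h y} (h-F c)
              (≈B-trans {FB (h c)} {FB r} {h y} (FB-cong {h c} {r} hc≈r) Fr≈hy))

      infinitelyManyZOrbits : InfinitelyManyZOrbits S
      infinitelyManyZOrbits (L , cover) =
        no-injection-into-list (λ k c → Orbit S c (lineS k)) L lineS-orbits-disjoint
          (λ k → cover (lineS k) (lineS-ZOrbit k))
        where
        lineS-orbits-disjoint : ∀ {m n c} → Orbit S c (lineS m) → Orbit S c (lineS n) → m ≡ n
        lineS-orbits-disjoint {m} {n} (i , o) (j , o′) = suc-injective (HasSlope-unique
          (HasSlope-orbit (i , swap o) (0 , 0 , Traces-lineS m))
          (HasSlope-orbit (j , swap o′) (0 , 0 , Traces-lineS n)))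

mainTheorem9 : (𝒜 : CompInj) → HasInfiniteOrbit (asStr 𝒜) →
    (C : ℕ → Set) → Cohesive C →
    InfinitelyManyZOrbits (CohPow 𝒜 C) ×
    (FinitelyManyZOrbits (asStr 𝒜) → ¬ Iso (asStr 𝒜) (CohPow 𝒜 C))
mainTheorem9 𝒜 ((a , a∈A) , a-inf) C (C-inf , _) =
  Transfer.infinitelyManyZOrbits (CohPow 𝒜 C) idIso ,
  λ finitelyMany iso → Transfer.infinitelyManyZOrbits (asStr 𝒜) iso finitelyMany
  where open CohesivePower 𝒜 C C-inf
        open Lines a a∈A a-inf
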